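{- Let $G$ be a digraph, let $X\subseteq V(G)$, let $r\geq 1$ and let $c:=\mathrm{wcol}_r(G)$. Then the number of distinct distance-$r$ vectors $D_r^-(v,X)$, $v\in V(G)$, is bounded by $((r+2)\cdot c\cdot |X|)^c$, and in particular $\nu_r^-(G,X)\leq ((r+2)\cdot c\cdot |X|)^c$.
   Context: For a digraph $G$, $N_r^-(v)$ is the set of vertices $u$ such that $G$ has a directed path of length at most $r$ from $u$ to $v$ (including $v$). $\nu_r^-(G,X)=|\{N_r^-(v)\cap X : v\in V(G)\}|$. For $X$ enumerated as $a_1,\dots,a_{|X|}$ (in some fixed order), $D_r^-(v,X)=(d_1,\dots,d_{|X|})$ where $d_i=\mathrm{dist}(a_i,v)$ (length of a shortest directed path from $a_i$ to $v$) if this is at most $r$, and $d_i=\infty$ otherwise. Weak coloring numbers: for a linear order $L$ of $V(G)$ and $r\ge0$, a vertex $u$ is weakly $r$-reachable from $v$ w.r.t. $L$ if there is a directed path $P$ of length at most $r$ between $u$ and $v$ (directed either from $u$ to $v$ or from $v$ to $u$) such that $u$ is the $L$-minimum vertex of $P$. $\mathrm{WReach}_r[G,L,v]$ is the set of vertices weakly $r$-reachable from $v$ (it contains $v$). $\mathrm{wcol}_r(G)=\min_L\max_{v\in V(G)}|\mathrm{WReach}_r[G,L,v]|$, the minimum over all linear orders $L$ of $V(G)$. -}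

module Defs where

open import Data.Nat using (ℕ; zero; suc; _≤_; _+_; _*_; _^_)
import Data.Nat as ℕ
open import Data.Bool using (Bool; true; false; _∧_; _∨_; T)
open import Data.Fin using (Fin; zero; suc; toℕ; fromℕ; inject₁; _≟_)
open import Data.Fin.Subset using (Subset; _∈_; ∣_∣)
open import Data.Fin.Permutation using (Permutation′; _⟨$⟩ʳ_)
open import Data.Maybe using (Maybe; just; nothing)
import Data.Maybe.Properties as MaybeP
open import Data.Vec using (Vec; tabulate; lookup)
import Data.Vec.Properties as VecP
open import Data.List using (List; length; map; deduplicate; allFin)
open import Data.Product using (Σ; ∃; _×_; _,_)
open import Function using (Injective; _⇔_)
open import Relation.Nullary using (does)
open import Relation.Binary.PropositionalEquality using (_≡_)
import Data.Bool.Properties as BoolP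

Digraph : ℕ → Set
Digraph n = Fin n → Fin n → Bool

anyFin : ∀ {n} → (Fin n → Bool) → Bool
anyFin {zero}  f = false
anyFin {suc n} f = f zero ∨ anyFin (λ i → f (suc i))

reach : ∀ {n} → Digraph n → ℕ → Fin n → Fin n → Bool
reach G zero    u v = does (u ≟ v)
reach G (suc k) u v = reach G k u v ∨ anyFin (λ w → reach G k u w ∧ G w v)

-- dist-search G r u v i : the least j with i ≤ j ≤ r and reach G j u v,
-- if any (searching upward from i; the fuel argument counts r - i).
distSearch : ∀ {n} → Digraph n → ℕ → (fuel i : ℕ) → Fin n → Fin n → Maybe ℕ
distSearch G r zero       i u v with reach G i u v
... | true  = just i
... | false = nothing
distSearch G r (suc fuel) i u v with reach G i u v
... | true  = just i
... | false = distSearch G r fuel (suc i) u v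

-- distR G r u v = just (dist(u,v))  if dist(u,v) ≤ r,  nothing (= ∞) otherwise.
distR : ∀ {n} → Digraph n → ℕ → Fin n → Fin n → Maybe ℕ
distR G r u v = distSearch G r r 0 u v

Dvec : ∀ {n k} → Digraph n → ℕ → Vec (Fin n) k → Fin n → Vec (Maybe ℕ) k
Dvec G r X v = tabulate (λ i → distR G r (lookup X i) v)

Nminus : ∀ {n} → Digraph n → ℕ → Fin n → Subset n
Nminus G r v = tabulate (λ u → reach G r u v)

toSubset : ∀ {n k} → Vec (Fin n) k → Subset n
toSubset X = tabulate (λ u → anyFin (λ i → does (lookup X i ≟ u)))

NminusX : ∀ {n k} → Digraph n → ℕ → Vec (Fin n) k → Fin n → Subset n
NminusX G r X v = tabulate (λ u → reach G r u v ∧ lookup (toSubset X) u)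

countDistinct : ∀ {n} {A : Set} → (_≟A_ : (a b : A) → Relation.Nullary.Dec (a ≡ b))
              → (Fin n → A) → ℕ
countDistinct _≟A_ f = length (deduplicate _≟A_ (map f (allFin _)))

numDvec : ∀ {n k} → Digraph n → ℕ → Vec (Fin n) k → ℕ
numDvec G r X = countDistinct (VecP.≡-dec (MaybeP.≡-dec ℕ._≟_)) (Dvec G r X)

nu : ∀ {n k} → Digraph n → ℕ → Vec (Fin n) k → ℕ
nu G r X = countDistinct (VecP.≡-dec BoolP._≟_) (NminusX G r X)

record DPath {n} (G : Digraph n) (m : ℕ) (x y : Fin n) : Set where
  field
    vert  : Fin (suc m) → Fin n
    inj   : Injective _≡_ _≡_ vert
    start : vert zero ≡ x
    end   : vert (fromℕ m) ≡ y
    arcs  : ∀ (i : Fin m) → T (G (vert (inject₁ i)) (vert (suc i)))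

-- A linear order L of V(G) is given by a permutation: u <_L w iff
-- pos L u < pos L w.
LinOrder : ℕ → Set
LinOrder n = Permutation′ n

pos : ∀ {n} → LinOrder n → Fin n → ℕ
pos L u = toℕ (L ⟨$⟩ʳ u)

IsMinOn : ∀ {n} {G : Digraph n} {m x y} → LinOrder n → Fin n → DPath G m x y → Set
IsMinOn L u P = ∀ i → pos L u ≤ pos L (DPath.vert P i)

WReach : ∀ {n} → Digraph n → ℕ → LinOrder n → Fin n → Fin n → Set
WReach G r L v u =
  Σ ℕ λ m → m ≤ r ×
    ((Σ (DPath G m u v) λ P → IsMinOn L u P) Data.Sum.⊎
     (Σ (DPath G m v u) λ P → IsMinOn L u P))
  where import Data.Sum

Card : ∀ {n} → (Fin n → Set) → ℕ → Set
Card {n} P k = Σ (Subset n) λ s → (∀ x → (x ∈ s) ⇔ P x) × ∣ s ∣ ≡ k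

MaxWReach≤ : ∀ {n} → Digraph n → ℕ → LinOrder n → ℕ → Set
MaxWReach≤ G r L c = ∀ v k → Card (WReach G r L v) k → k ≤ c

IsWcol : ∀ {n} → Digraph n → ℕ → ℕ → Set
IsWcol {n} G r c =
  (Σ (LinOrder n) λ L → MaxWReach≤ G r L c) ×
  (∀ (L : LinOrder n) c′ → MaxWReach≤ G r L c′ → c ≤ c′)

module Submission where

-- Fix an order L witnessing c = wcol_r(G).  For a vertex a and a
-- walk of length d ≤ r from a to v, the L-least vertex w of the walk is weakly r-reachable
-- from both a and v, and splits the walk into pieces of lengths t₁ + t₂ ≤ d.  Enumerate
-- each set WReach_r[v] by c indices.  For every index j, the j-th weakly reachable vertex
-- w of v gets a "slot": either nothing, or a pair (i′, j′) naming w as the j′-th weakly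
-- reachable vertex of a_{i′}, together with dist(w, v).  Whether a_i reaches v within
-- d ≤ r is then decided by the c slots of v alone, so the slot vector of v determines both
-- D_r^-(v, X) and N_r^-(v) ∩ X.  Slot vectors range over a set of size
-- (1 + k·c·(r+1))^c ≤ ((r+2)·c·k)^c, which bounds both counts.

open import Defs
open import Data.Bool using (Bool; true; false; T; _∧_; _∨_)
open import Data.Bool.Properties using (T-∧; T-∨; T-≡; ⇔→≡; ∧-zeroʳ)
open import Data.Empty using (⊥-elim)
open import Data.Fin using (Fin; zero; suc; toℕ; fromℕ; fromℕ<; inject₁; combine; funToFin; finToFun; _≟_)
open import Data.Fin.Properties
  using ( toℕ-injective; toℕ-fromℕ; toℕ-inject₁; toℕ<n; toℕ-fromℕ<; suc-injective
        ; combine-injective; finToFun-funToFin; injective⇒≤; any? )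
open import Data.Fin.Subset using (Subset; ∣_∣) renaming (_∈_ to _∈ₛ_)
open import Data.List using (List; []; _∷_; length; map; upTo; deduplicate; allFin)
import Data.List as List
open import Data.List.Extrema.Nat using (argmin; argmin-all; f[argmin]≤f[xs])
open import Data.List.Membership.Propositional using (_∈_)
open import Data.List.Membership.Propositional.Properties
  using (∈-map⁺; ∈-map⁻; ∈-deduplicate⁻; ∈-lookup; ∈-upTo⁺; ∈-upTo⁻)
open import Data.List.Properties using (length-map)
open import Data.List.Relation.Unary.All as All using (All)
open import Data.List.Relation.Unary.Any using (here; there)
open import Data.List.Relation.Unary.AllPairs using (_∷_)
open import Data.List.Relation.Unary.Unique.Propositional using (Unique)
open import Data.List.Relation.Unary.Unique.DecPropositional.Properties using (deduplicate-!)
open import Data.Maybe using (Maybe; just; nothing)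
open import Data.Nat using (ℕ; zero; suc; _≤_; _<_; _+_; _*_; _^_; _∸_; _≤ᵇ_; _≤?_; z≤n; s≤s; s≤s⁻¹)
open import Data.Nat.Properties
  using ( ≤-refl; ≤-reflexive; ≤-trans; ≤-antisym; <⇒≤; <-≤-trans; <-irrefl; <-cmp; 1+n≰n
        ; m≤n⇒m<n∨m≡n; m≤n⇒m≤1+n; m≤m+n; ≤ᵇ⇒≤; ≤⇒≤ᵇ; +-identityʳ; +-suc; +-comm
        ; +-monoʳ-≤; +-monoʳ-<; +-monoˡ-<; *-mono-≤; ^-monoˡ-≤
        ; m∸n≤m; m+[n∸m]≡n; m∸n+n≡m; m+n≤o⇒n≤o; m+n≤o⇒m≤o∸n; module ≤-Reasoning )
open import Data.Nat.Solver using (module +-*-Solver)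
open import Data.Product using (Σ; ∃; ∃₂; _×_; _,_; proj₁; proj₂)
import Data.Product as Product
open import Data.Sum using (_⊎_; inj₁; inj₂; [_,_])
open import Data.Vec using (Vec; []; _∷_; lookup; tabulate; here; there)
open import Data.Vec.Properties using (tabulate-cong; lookup∘tabulate; []=⇒lookup; lookup⇒[]=)
open import Function using (_∘_; id; _⇔_; mk⇔; Injective)
open import Function.Bundles using (module Equivalence)
open import Relation.Binary using (tri<; tri≈; tri>; DecidableEquality)
open import Relation.Binary.PropositionalEquality using (_≡_; refl; sym; trans; cong; subst; subst₂)
open import Relation.Nullary using (Dec; yes; no; does; ¬_; contradiction)
open import Relation.Nullary.Decidable using (dec-true)

open Equivalence using (to; from)
open +-*-Solver using (solve; _:=_; _:+_; _:*_; con)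

T-extensional : ∀ {a b : Bool} → (T a → T b) → (T b → T a) → a ≡ b
T-extensional a⇒b b⇒a = ⇔→≡ {z = true}
  (mk⇔ (to T-≡ ∘ a⇒b ∘ from T-≡) (to T-≡ ∘ b⇒a ∘ from T-≡))

anyFin-intro : ∀ {n} (f : Fin n → Bool) x → T (f x) → T (anyFin f)
anyFin-intro f zero    fx = from T-∨ (inj₁ fx)
anyFin-intro f (suc x) fx = from T-∨ (inj₂ (anyFin-intro (f ∘ suc) x fx))

anyFin-elim : ∀ {n} (f : Fin n → Bool) → T (anyFin f) → ∃ λ x → T (f x)
anyFin-elim {suc n} f holds with to T-∨ holds
... | inj₁ f0   = zero , f0
... | inj₂ rest = Product.map suc id (anyFin-elim (f ∘ suc) rest)

least-on-range : (h : ℕ → ℕ) (m : ℕ) → ∃ λ t → t ≤ m × (∀ s → s ≤ m → h t ≤ h s)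
least-on-range h m =
    argmin h 0 range
  , s≤s⁻¹ (argmin-all h (s≤s z≤n) (All.tabulate ∈-upTo⁻))
  , λ s s≤m → All.lookup (f[argmin]≤f[xs] {f = h} 0 range) (∈-upTo⁺ (s≤s s≤m))
  where
  range : List ℕ
  range = upTo (suc m)

shorter : ∀ {p q m} → p < q → q ≤ m → p + (m ∸ q) < m
shorter {p} {q} {m} p<q q≤m = begin-strict
  p + (m ∸ q) <⟨ +-monoˡ-< (m ∸ q) p<q ⟩
  q + (m ∸ q) ≡⟨ m+[n∸m]≡n q≤m ⟩
  m           ∎
  where open ≤-Reasoning

-- u reaches v by a walk of length at most k in H.  (A record around the boolean reach,
-- so that its indices can be inferred.)
record Reaches {n} (H : Digraph n) (k : ℕ) (u v : Fin n) : Set where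
  constructor ⟨_⟩
  field holds : T (reach H k u v)

module _ {n : ℕ} (H : Digraph n) where

  record Walk (m : ℕ) (x y : Fin n) : Set where
    field
      at    : ℕ → Fin n
      start : at 0 ≡ x
      end   : at m ≡ y
      steps : ∀ i → i < m → T (H (at i) (at (suc i)))

  IsPath : ∀ {m x y} → Walk m x y → Set
  IsPath {m} W = ∀ i j → i ≤ m → j ≤ m → Walk.at W i ≡ Walk.at W j → i ≡ j

  reach-suc : ∀ {k u v} → Reaches H k u v → Reaches H (suc k) u v
  reach-suc ⟨ uv ⟩ = ⟨ from T-∨ (inj₁ uv) ⟩

  reach-snoc : ∀ {k u w v} → Reaches H k u w → T (H w v) → Reaches H (suc k) u v
  reach-snoc {w = w} ⟨ uw ⟩ wv = ⟨ from T-∨ (inj₂ (anyFin-intro _ w (from T-∧ (uw , wv)))) ⟩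

  reach-zero : ∀ {u v} → Reaches H 0 u v → u ≡ v
  reach-zero {u} {v} ⟨ uv ⟩ with u ≟ v
  ... | yes u≡v = u≡v

  reach-refl : ∀ {u} → Reaches H 0 u u
  reach-refl {u} = ⟨ from T-≡ (dec-true (u ≟ u) refl) ⟩

  reach-mono : ∀ {k k′ u v} → k ≤ k′ → Reaches H k u v → Reaches H k′ u v
  reach-mono {k′ = zero}   z≤n uv = uv
  reach-mono {k′ = suc k′} k≤ uv with m≤n⇒m<n∨m≡n k≤
  ... | inj₁ (s≤s k≤k′) = reach-suc (reach-mono k≤k′ uv)
  ... | inj₂ refl       = uv

  reach-unsnoc : ∀ {k u v} → Reaches H (suc k) u v →
                 Reaches H k u v ⊎ ∃ λ w → Reaches H k u w × T (H w v)
  reach-unsnoc {k} {u} {v} ⟨ uv ⟩ with to T-∨ uv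
  ... | inj₁ short   = inj₁ ⟨ short ⟩
  ... | inj₂ viaLast with anyFin-elim (λ w → reach H k u w ∧ H w v) viaLast
  ... | w , uwv = inj₂ (w , Product.map ⟨_⟩ id (to T-∧ uwv))

  reach-++ : ∀ {j k a w v} → Reaches H j a w → Reaches H k w v → Reaches H (j + k) a v
  reach-++ {j} {zero} {a} aw wv rewrite +-identityʳ j = subst (Reaches H j a) (reach-zero wv) aw
  reach-++ {j} {suc k} aw wv rewrite +-suc j k with reach-unsnoc wv
  ... | inj₁ wv′            = reach-suc (reach-++ aw wv′)
  ... | inj₂ (x , wx , xv) = reach-snoc (reach-++ aw wx) xv

  reach-along : ∀ m (f : Fin (suc m) → Fin n) → (∀ i → T (H (f (inject₁ i)) (f (suc i)))) →
                Reaches H m (f zero) (f (fromℕ m))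
  reach-along zero    f arcs = reach-refl
  reach-along (suc m) f arcs =
    reach-snoc (reach-along m (f ∘ inject₁) (arcs ∘ inject₁)) (arcs (fromℕ m))

  module _ {m x y} (W : Walk m x y) where
    open Walk W

    atᶠ : Fin (suc m) → Fin n
    atᶠ = at ∘ toℕ

    atᶠ-end : atᶠ (fromℕ m) ≡ y
    atᶠ-end = trans (cong at (toℕ-fromℕ m)) end

    stepsᶠ : ∀ i → T (H (atᶠ (inject₁ i)) (atᶠ (suc i)))
    stepsᶠ i = subst (λ j → T (H (at j) (at (suc (toℕ i))))) (sym (toℕ-inject₁ i)) (steps (toℕ i) (toℕ<n i))

  walk⇒reach : ∀ {m x y} → Walk m x y → Reaches H m x y
  walk⇒reach {m} W = subst₂ (Reaches H m) (Walk.start W) (atᶠ-end W) (reach-along m (atᶠ W) (stepsᶠ W))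

  walk-snoc : ∀ {m x w y} → Walk m x w → T (H w y) → Walk (suc m) x y
  walk-snoc {m} {x} {w} {y} W wy = record
    { at = at′ ; start = trans (at′-≤ z≤n) start ; end = at′-last ; steps = steps′ }
    where
    open Walk W
    at′ : ℕ → Fin n
    at′ i with i ≤? m
    ... | yes _ = at i
    ... | no  _ = y
    at′-≤ : ∀ {i} → i ≤ m → at′ i ≡ at i
    at′-≤ {i} i≤m with i ≤? m
    ... | yes _   = refl
    ... | no  i≰m = contradiction i≤m i≰m
    at′-last : at′ (suc m) ≡ y
    at′-last with suc m ≤? m
    ... | yes m<m = contradiction m<m 1+n≰n
    ... | no  _   = refl
    steps′ : ∀ i → i < suc m → T (H (at′ i) (at′ (suc i)))
    steps′ i (s≤s i≤m) with m≤n⇒m<n∨m≡n i≤m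
    ... | inj₁ i<m  rewrite at′-≤ i≤m | at′-≤ i<m = steps i i<m
    ... | inj₂ refl rewrite at′-≤ i≤m | at′-last  = subst (λ z → T (H z y)) (sym end) wy

  reach⇒walk : ∀ {k x y} → Reaches H k x y → ∃ λ m → m ≤ k × Walk m x y
  reach⇒walk {zero} {x} xy =
    0 , z≤n , record { at = λ _ → x ; start = refl ; end = reach-zero xy ; steps = λ _ () }
  reach⇒walk {suc k} xy with reach-unsnoc xy
  ... | inj₁ xy′ = Product.map id (Product.map m≤n⇒m≤1+n id) (reach⇒walk xy′)
  ... | inj₂ (w , xw , wy) with reach⇒walk xw
  ... | m , m≤k , W = suc m , s≤s m≤k , walk-snoc W wy

  prefix : ∀ {m x y} (W : Walk m x y) {s} → s ≤ m → Walk s x (Walk.at W s)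
  prefix W s≤m = record
    { at = at ; start = start ; end = refl ; steps = λ i i<s → steps i (<-≤-trans i<s s≤m) }
    where open Walk W

  suffix : ∀ {m x y} (W : Walk m x y) {s} → s ≤ m → Walk (m ∸ s) (Walk.at W s) y
  suffix {m} W {s} s≤m = record
    { at = λ i → at (s + i)
    ; start = cong at (+-identityʳ s)
    ; end = trans (cong at (m+[n∸m]≡n s≤m)) end
    ; steps = λ i i<m∸s → subst (λ j → T (H (at (s + i)) (at j))) (sym (+-suc s i))
                            (steps (s + i) (subst (s + i <_) (m+[n∸m]≡n s≤m) (+-monoʳ-< s i<m∸s)))
    }
    where open Walk W

  shortcut : ∀ {m x y} (W : Walk m x y) {p q} → p < q → q ≤ m → Walk.at W p ≡ Walk.at W q →
             Reaches H (p + (m ∸ q)) x y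
  shortcut W {p} p<q q≤m atₚ≡at_q =
    reach-++ (subst (Reaches H p _) atₚ≡at_q (walk⇒reach (prefix W (≤-trans (<⇒≤ p<q) q≤m))))
             (walk⇒reach (suffix W q≤m))

  minimal⇒path : ∀ {m x y} (W : Walk m x y) → (∀ {j} → j < m → ¬ Reaches H j x y) → IsPath W
  minimal⇒path {m} W noShorter i j i≤m j≤m atᵢ≡atⱼ with <-cmp i j
  ... | tri< i<j _ _ = contradiction (shortcut W i<j j≤m atᵢ≡atⱼ) (noShorter (shorter i<j j≤m))
  ... | tri≈ _ i≡j _ = i≡j
  ... | tri> _ _ j<i = contradiction (shortcut W j<i i≤m (sym atᵢ≡atⱼ)) (noShorter (shorter j<i i≤m))

module _ {n : ℕ} (H : Digraph n) (r : ℕ) where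

  private
    unreached : ∀ {i u v} → reach H i u v ≡ false → ¬ Reaches H i u v
    unreached uv≡false ⟨ uv ⟩ = subst T uv≡false uv

  search-sound : ∀ fuel i {u v d} → distSearch H r fuel i u v ≡ just d → Reaches H d u v × d ≤ i + fuel
  search-sound zero i {u} {v} found with reach H i u v in uv
  search-sound zero i refl | true  = ⟨ from T-≡ uv ⟩ , ≤-reflexive (sym (+-identityʳ i))
  search-sound zero i ()   | false
  search-sound (suc fuel) i {u} {v} found with reach H i u v in uv
  search-sound (suc fuel) i refl  | true  = ⟨ from T-≡ uv ⟩ , m≤m+n i (suc fuel)
  search-sound (suc fuel) i {d = d} found | false =
    Product.map₂ (subst (d ≤_) (sym (+-suc i fuel))) (search-sound fuel (suc i) found)

  search-least : ∀ fuel i {u v j} → Reaches H j u v → i ≤ j → j ≤ i + fuel →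
                 ∃ λ d → distSearch H r fuel i u v ≡ just d × d ≤ j
  search-least zero i {u} {v} uv i≤j j≤i+0 with reach H i u v in uvᵢ
  ... | true  = i , refl , i≤j
  ... | false with refl ← ≤-antisym i≤j (subst (_ ≤_) (+-identityʳ i) j≤i+0) =
    contradiction uv (unreached uvᵢ)
  search-least (suc fuel) i {u} {v} {j} uv i≤j j≤ with reach H i u v in uvᵢ
  ... | true  = i , refl , i≤j
  ... | false with m≤n⇒m<n∨m≡n i≤j
  ...   | inj₁ i<j  = search-least fuel (suc i) uv i<j (subst (j ≤_) (+-suc i fuel) j≤)
  ...   | inj₂ refl = contradiction uv (unreached uvᵢ)

  search-cong : ∀ fuel i {u v u′ v′} → (∀ j → j ≤ i + fuel → reach H j u v ≡ reach H j u′ v′) →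
                distSearch H r fuel i u v ≡ distSearch H r fuel i u′ v′
  search-cong zero i {u} {v} {u′} {v′} same
    with reach H i u v | reach H i u′ v′ | same i (m≤m+n i 0)
  ... | true  | .true  | refl = refl
  ... | false | .false | refl = refl
  search-cong (suc fuel) i {u} {v} {u′} {v′} same
    with reach H i u v | reach H i u′ v′ | same i (m≤m+n i (suc fuel))
  ... | true  | .true  | refl = refl
  ... | false | .false | refl =
    search-cong fuel (suc i) λ j j≤ → same j (subst (j ≤_) (sym (+-suc i fuel)) j≤)

  dist-sound : ∀ {u v d} → distR H r u v ≡ just d → Reaches H d u v × d ≤ r
  dist-sound = search-sound r 0

  dist-least : ∀ {u v j} → Reaches H j u v → j ≤ r → ∃ λ d → distR H r u v ≡ just d × d ≤ j
  dist-least uv j≤r = search-least r 0 uv z≤n j≤r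

  dist-cong : ∀ {u v u′ v′} → (∀ j → j ≤ r → reach H j u v ≡ reach H j u′ v′) →
              distR H r u v ≡ distR H r u′ v′
  dist-cong = search-cong r 0

-- Every reachable pair is joined by a path of length at most k: a shortest walk.
reach⇒path : ∀ {n} (H : Digraph n) {k x y} → Reaches H k x y →
             ∃ λ m → m ≤ k × Σ (Walk H m x y) (IsPath H)
reach⇒path H {k} {x} {y} xy with dist-least H k xy ≤-refl
... | d , dist≡d , d≤k with reach⇒walk H (proj₁ (dist-sound H k dist≡d))
... | m , m≤d , W = m , ≤-trans m≤d d≤k , W , minimal⇒path H W noShorter
  where
  noShorter : ∀ {j} → j < m → ¬ Reaches H j x y
  noShorter {j} j<m xyⱼ with dist-least H k xyⱼ (≤-trans (<⇒≤ j<m) (≤-trans m≤d d≤k))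
  ... | d′ , dist≡d′ , d′≤j with refl ← trans (sym dist≡d) dist≡d′ =
    <-irrefl refl (<-≤-trans j<m (≤-trans m≤d d′≤j))

path⇒DPath : ∀ {n} {H : Digraph n} {m x y} (W : Walk H m x y) → IsPath H W → DPath H m x y
path⇒DPath {H = H} W distinct = record
  { vert  = atᶠ H W
  ; inj   = λ {i} {j} same → toℕ-injective (distinct (toℕ i) (toℕ j) (s≤s⁻¹ (toℕ<n i)) (s≤s⁻¹ (toℕ<n j)) same)
  ; start = Walk.start W
  ; end   = atᶠ-end H W
  ; arcs  = stepsᶠ H W
  }

induced : ∀ {n} → Digraph n → (Fin n → Bool) → Digraph n
induced G keep x y = G x y ∧ (keep x ∧ keep y)

module _ {n} (G : Digraph n) (keep : Fin n → Bool) where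

  induced-arc : ∀ {x y} → T (induced G keep x y) → T (G x y) × T (keep x) × T (keep y)
  induced-arc {x} {y} arc = Product.map₂ (to (T-∧ {keep x} {keep y})) (to (T-∧ {G x y}) arc)

  walk-forget : ∀ {m x y} → Walk (induced G keep) m x y → Walk G m x y
  walk-forget W = record
    { at = at ; start = start ; end = end ; steps = λ i i<m → proj₁ (induced-arc (steps i i<m)) }
    where open Walk W

  walk-restrict : ∀ {m x y} (W : Walk G m x y) → (∀ i → i ≤ m → T (keep (Walk.at W i))) →
                  Walk (induced G keep) m x y
  walk-restrict W kept = record
    { at = at ; start = start ; end = end
    ; steps = λ i i<m → from T-∧ (steps i i<m , from T-∧ (kept i (<⇒≤ i<m) , kept (suc i) i<m)) }
    where open Walk W

  -- Every vertex of a walk in the induced subdigraph is kept, provided the start (or the end)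
  -- is: all other vertices lie on arcs.
  kept-from-start : ∀ {m x y} (W : Walk (induced G keep) m x y) → T (keep x) →
                    ∀ i → i ≤ m → T (keep (Walk.at W i))
  kept-from-start W keepₓ zero    _   = subst (T ∘ keep) (sym (Walk.start W)) keepₓ
  kept-from-start W keepₓ (suc i) i<m = proj₂ (proj₂ (induced-arc (Walk.steps W i i<m)))

  kept-from-end : ∀ {m x y} (W : Walk (induced G keep) m x y) → T (keep y) →
                  ∀ i → i ≤ m → T (keep (Walk.at W i))
  kept-from-end W keepᵧ i i≤m with m≤n⇒m<n∨m≡n i≤m
  ... | inj₁ i<m  = proj₁ (proj₂ (induced-arc (Walk.steps W i i<m)))
  ... | inj₂ refl = subst (T ∘ keep) (sym (Walk.end W)) keepᵧ

module WeakReachability {n} (G : Digraph n) (r : ℕ) (L : LinOrder n) where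

  notBelow : Fin n → Fin n → Bool
  notBelow u x = pos L u ≤ᵇ pos L x

  notBelow-refl : ∀ u → T (notBelow u u)
  notBelow-refl u = ≤⇒≤ᵇ (≤-refl {pos L u})

  -- G restricted to the vertices not below u: u is the L-minimum of every walk in it
  -- through u.
  Above : Fin n → Digraph n
  Above u = induced G (notBelow u)

  wreach? : Fin n → Fin n → Bool
  wreach? v u = reach (Above u) r u v ∨ reach (Above u) r v u

  minimal-path : ∀ {u x y} → Reaches (Above u) r x y → x ≡ u ⊎ y ≡ u →
                 Σ ℕ λ m → m ≤ r × Σ (DPath G m x y) (IsMinOn L u)
  minimal-path {u} {x} {y} xy endpointU with reach⇒path (Above u) xy
  ... | m , m≤r , W , distinct =
    m , m≤r , path⇒DPath (walk-forget G (notBelow u) W) distinct ,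
    λ i → ≤ᵇ⇒≤ _ _ (allAbove (toℕ i) (s≤s⁻¹ (toℕ<n i)))
    where
    uAbove : ∀ {z} → z ≡ u → T (notBelow u z)
    uAbove z≡u = subst (T ∘ notBelow u) (sym z≡u) (notBelow-refl u)
    allAbove : ∀ i → i ≤ m → T (notBelow u (Walk.at W i))
    allAbove = [ kept-from-start G (notBelow u) W ∘ uAbove , kept-from-end G (notBelow u) W ∘ uAbove ] endpointU

  minimal-path⇒reach : ∀ {u m x y} (P : DPath G m x y) → IsMinOn L u P → Reaches (Above u) m x y
  minimal-path⇒reach {u} {m} P minimal = subst₂ (Reaches (Above u) m) start end
    (reach-along (Above u) m vert λ i →
      from T-∧ (arcs i , from T-∧ (≤⇒≤ᵇ (minimal (inject₁ i)) , ≤⇒≤ᵇ (minimal (suc i)))))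
    where open DPath P

  wreach?-sound : ∀ {v u} → T (wreach? v u) → WReach G r L v u
  wreach?-sound {v} {u} vu with to (T-∨ {reach (Above u) r u v}) vu
  ... | inj₁ u⇝v = Product.map₂ (Product.map₂ inj₁) (minimal-path ⟨ u⇝v ⟩ (inj₁ refl))
  ... | inj₂ v⇝u = Product.map₂ (Product.map₂ inj₂) (minimal-path ⟨ v⇝u ⟩ (inj₂ refl))

  wreach?-complete : ∀ {v u} → WReach G r L v u → T (wreach? v u)
  wreach?-complete (m , m≤r , inj₁ (P , minimal)) =
    from T-∨ (inj₁ (Reaches.holds (reach-mono _ m≤r (minimal-path⇒reach P minimal))))
  wreach?-complete (m , m≤r , inj₂ (P , minimal)) =
    from T-∨ (inj₂ (Reaches.holds (reach-mono _ m≤r (minimal-path⇒reach P minimal))))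

  -- The key observation: the L-least vertex w of a walk of length ≤ r from a to v splits it
  -- into walks a ⇝ w and w ⇝ v inside Above w, so w is weakly r-reachable from a and from v.
  split-at-minimum : ∀ {d a v} → Reaches G d a v → d ≤ r →
    ∃ λ w → ∃₂ λ t₁ t₂ → t₁ + t₂ ≤ d × Reaches G t₁ a w × Reaches G t₂ w v ×
                          T (wreach? a w) × T (wreach? v w)
  split-at-minimum {d} {a} {v} av d≤r with reach⇒walk G av
  ... | m , m≤d , W with least-on-range (pos L ∘ Walk.at W) m
  ... | t , t≤m , least =
      at t , t , m ∸ t
    , ≤-trans (≤-reflexive (m+[n∸m]≡n t≤m)) m≤d
    , walk⇒reach G (prefix G W t≤m)
    , walk⇒reach G (suffix G W t≤m)
    , from T-∨ (inj₂ (Reaches.holds (reach-mono _ (≤-trans t≤m m≤r) (walk⇒reach _ (prefix _ Wᵃ t≤m)))))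
    , from T-∨ (inj₁ (Reaches.holds (reach-mono _ (≤-trans (m∸n≤m m t) m≤r) (walk⇒reach _ (suffix _ Wᵃ t≤m)))))
    where
    open Walk W
    m≤r : m ≤ r
    m≤r = ≤-trans m≤d d≤r
    Wᵃ : Walk (Above (at t)) m a v
    Wᵃ = walk-restrict G (notBelow (at t)) W λ i i≤m → ≤⇒≤ᵇ (least i i≤m)

∈-tabulate : ∀ {n} {f : Fin n → Bool} {x} → x ∈ₛ tabulate f ⇔ T (f x)
∈-tabulate {f = f} {x} = mk⇔
  (λ x∈ → from T-≡ (trans (sym (lookup∘tabulate f x)) ([]=⇒lookup x∈)))
  (λ fx → lookup⇒[]= x (tabulate f) (trans (lookup∘tabulate f x) (to T-≡ fx)))

elements : ∀ {n} → Subset n → List (Fin n)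
elements []          = []
elements (true  ∷ s) = zero ∷ map suc (elements s)
elements (false ∷ s) = map suc (elements s)

elements-length : ∀ {n} (s : Subset n) → length (elements s) ≡ ∣ s ∣
elements-length []          = refl
elements-length (true  ∷ s) = cong suc (trans (length-map suc (elements s)) (elements-length s))
elements-length (false ∷ s) = trans (length-map suc (elements s)) (elements-length s)

elements-complete : ∀ {n} {s : Subset n} {x} → x ∈ₛ s → x ∈ elements s
elements-complete {s = true  ∷ s} here        = here refl
elements-complete {s = true  ∷ s} (there x∈s) = there (∈-map⁺ suc (elements-complete x∈s))
elements-complete {s = false ∷ s} (there x∈s) = ∈-map⁺ suc (elements-complete x∈s)

cover : ∀ {A : Set} {c} (xs : List A) → length xs ≤ c → A →
        Σ (Fin c → A) λ e → ∀ {x} → x ∈ xs → ∃ λ j → e j ≡ x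
cover [] _ default = (λ _ → default) , λ ()
cover {c = suc c} (x ∷ xs) (s≤s length≤c) default with cover xs length≤c default
... | e , covered =
  (λ { zero → x ; (suc j) → e j }) ,
  λ { (here refl) → zero , refl ; (there x∈xs) → Product.map suc id (covered x∈xs) }

unique-lookup : ∀ {A : Set} {xs : List A} → Unique xs → ∀ {p q} → List.lookup xs p ≡ List.lookup xs q → p ≡ q
unique-lookup (_  ∷ _) {zero}  {zero}  _  = refl
unique-lookup (x∉ ∷ _) {zero}  {suc q} eq = ⊥-elim (All.lookup x∉ (∈-lookup q) eq)
unique-lookup (x∉ ∷ _) {suc p} {zero}  eq = ⊥-elim (All.lookup x∉ (∈-lookup p) (sym eq))
unique-lookup (_  ∷ u) {suc p} {suc q} eq = cong suc (unique-lookup u eq)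

countDistinct-≤ : ∀ {n N} {A : Set} (_≟ᴬ_ : DecidableEquality A) (f : Fin n → A) (g : Fin n → Fin N) →
                  (∀ {u v} → g u ≡ g v → f u ≡ f v) → countDistinct _≟ᴬ_ f ≤ N
countDistinct-≤ {n} {A = A} _≟ᴬ_ f g determined = injective⇒≤ {f = g ∘ representative} injective
  where
  values : List A
  values = deduplicate _≟ᴬ_ (map f (allFin n))
  witness : ∀ p → ∃ λ u → u ∈ allFin n × List.lookup values p ≡ f u
  witness p = ∈-map⁻ f (∈-deduplicate⁻ _≟ᴬ_ (map f (allFin n)) (∈-lookup p))
  representative : Fin (length values) → Fin n
  representative p = proj₁ (witness p)
  injective : ∀ {p q} → g (representative p) ≡ g (representative q) → p ≡ q
  injective {p} {q} same = unique-lookup (deduplicate-! _≟ᴬ_ (map f (allFin n)))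
    (trans (proj₂ (proj₂ (witness p))) (trans (determined same) (sym (proj₂ (proj₂ (witness q))))))

encodeTriple : ∀ {a b e} → Maybe (Fin a × Fin b × Fin e) → Fin (suc (a * (b * e)))
encodeTriple nothing            = zero
encodeTriple (just (i , j , d)) = suc (combine i (combine j d))

encodeTriple-injective : ∀ {a b e} → Injective _≡_ _≡_ (encodeTriple {a} {b} {e})
encodeTriple-injective {x = nothing}          {nothing}             _  = refl
encodeTriple-injective {x = just (i , j , d)} {just (i′ , j′ , d′)} eq
  with refl , inner ← combine-injective i (combine j d) i′ (combine j′ d′) (suc-injective eq)
  with refl , refl  ← combine-injective j d j′ d′ inner = refl

funToFin-injective : ∀ {c M} {f g : Fin c → Fin M} → funToFin f ≡ funToFin g → ∀ j → f j ≡ g j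
funToFin-injective {f = f} {g} same j =
  trans (sym (finToFun-funToFin f j)) (trans (cong (λ x → finToFun x j) same) (finToFun-funToFin g j))

module Slots {n k} (G : Digraph n) (X : Vec (Fin n) k) (r c : ℕ) (L : LinOrder n)
             (maxWReach : MaxWReach≤ G r L c) where
  open WeakReachability G r L

  wreachSet : Fin n → Subset n
  wreachSet v = tabulate (wreach? v)

  wreachSet-size : ∀ v → ∣ wreachSet v ∣ ≤ c
  wreachSet-size v = maxWReach v _
    (wreachSet v , (λ x → mk⇔ (wreach?-sound ∘ to ∈-tabulate) (from ∈-tabulate ∘ wreach?-complete)) , refl)

  enumeration : (v : Fin n) → Σ (Fin c → Fin n) λ e → ∀ {w} → w ∈ elements (wreachSet v) → ∃ λ j → e j ≡ w
  enumeration v =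
    cover (elements (wreachSet v)) (subst (_≤ c) (sym (elements-length (wreachSet v))) (wreachSet-size v)) v

  enum : Fin n → Fin c → Fin n
  enum v = proj₁ (enumeration v)

  enum-covers : ∀ {v w} → T (wreach? v w) → ∃ λ j → enum v j ≡ w
  enum-covers {v} vw = proj₂ (enumeration v) (elements-complete (from ∈-tabulate vw))

  Listed : Fin n → Set
  Listed w = ∃₂ λ i j → enum (lookup X i) j ≡ w

  listed? : ∀ w → Dec (Listed w)
  listed? w = any? λ i → any? λ j → enum (lookup X i) j ≟ w

  -- A slot names a listed vertex w by its indices (i, j) and records dist(w, v) ≤ r.
  Slot : Set
  Slot = Maybe (Fin k × Fin c × Fin (suc r))

  slotFor : ∀ {w v} → Dec (Listed w) → (dist : Maybe ℕ) → distR G r w v ≡ dist → Slot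
  slotFor (yes (i , j , _)) (just d) dist≡ = just (i , j , fromℕ< (s≤s (proj₂ (dist-sound G r dist≡))))
  slotFor _                 _        _     = nothing

  slotOf : Fin n → Fin n → Slot
  slotOf w v = slotFor (listed? w) (distR G r w v) refl

  slot : Fin n → Fin c → Slot
  slot v j = slotOf (enum v j) v

  -- A slot names a vertex at the recorded distance from v … (proved for slotFor with
  -- arbitrary arguments, so that plain pattern matching applies, then instantiated).
  slotFor-sound : ∀ {w v i j d} (listed : Dec (Listed w)) dist (dist≡ : distR G r w v ≡ dist) →
                  slotFor listed dist dist≡ ≡ just (i , j , d) → enum (lookup X i) j ≡ w × Reaches G (toℕ d) w v
  slotFor-sound {w} {v} (yes (i , j , named)) (just d) dist≡ refl =
    named , subst (λ t → Reaches G t w v) (sym (toℕ-fromℕ< _)) (proj₁ (dist-sound G r dist≡))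

  slotOf-sound : ∀ {w v i j d} → slotOf w v ≡ just (i , j , d) → enum (lookup X i) j ≡ w × Reaches G (toℕ d) w v
  slotOf-sound {w} {v} = slotFor-sound (listed? w) (distR G r w v) refl

  slotFor-complete : ∀ {w v t} (listed : Dec (Listed w)) dist (dist≡ : distR G r w v ≡ dist) →
                     Listed w → Reaches G t w v → t ≤ r →
                     ∃ λ i → ∃ λ j → ∃ λ d → slotFor listed dist dist≡ ≡ just (i , j , d) × toℕ d ≤ t
  slotFor-complete (no unlisted) _ _ isListed _ _ = contradiction isListed unlisted
  slotFor-complete (yes (i , j , _)) dist dist≡ _ wv t≤r with dist-least G r wv t≤r
  ... | d , dist≡d , d≤t with refl ← trans (sym dist≡) dist≡d =
    i , j , _ , refl , subst (_≤ _) (sym (toℕ-fromℕ< _)) d≤t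

  slotOf-complete : ∀ {w v t} → Listed w → Reaches G t w v → t ≤ r →
                    ∃ λ i → ∃ λ j → ∃ λ d → slotOf w v ≡ just (i , j , d) × toℕ d ≤ t
  slotOf-complete {w} {v} = slotFor-complete (listed? w) (distR G r w v) refl

  reach-via-slot : ∀ {v j i′ j′ d₂ d a} → slot v j ≡ just (i′ , j′ , d₂) → toℕ d₂ ≤ d →
                   Reaches G (d ∸ toℕ d₂) a (enum (lookup X i′) j′) → Reaches G d a v
  reach-via-slot {d₂ = d₂} {d} slot≡ d₂≤d aw with slotOf-sound slot≡
  ... | named , wv = subst (λ t → Reaches G t _ _) (m∸n+n≡m d₂≤d) (reach-++ G (subst (Reaches G _ _) named aw) wv)

  -- Conversely, every walk of length d ≤ r from a_i to v is certified by some slot of v: the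
  -- L-least vertex of the walk is weakly reachable from v and listed for a_i.
  slot-via-reach : ∀ {i v d} → Reaches G d (lookup X i) v → d ≤ r →
    ∃ λ j → ∃ λ i′ → ∃ λ j′ → ∃ λ d₂ → slot v j ≡ just (i′ , j′ , d₂) × toℕ d₂ ≤ d ×
      Reaches G (d ∸ toℕ d₂) (lookup X i) (enum (lookup X i′) j′)
  slot-via-reach {i} {v} {d} av d≤r =
    let w , t₁ , t₂ , t₁+t₂≤d , aw , wv , a⇝w , v⇝w = split-at-minimum av d≤r
        j  , enumᵥ≡w = enum-covers {v} {w} v⇝w
        j₀ , enumₐ≡w = enum-covers {lookup X i} {w} a⇝w
        t₂≤d = m+n≤o⇒n≤o t₁ t₁+t₂≤d
        i′ , j′ , d₂ , slot≡ , d₂≤t₂ =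
          slotOf-complete (i , j₀ , trans enumₐ≡w (sym enumᵥ≡w))
                          (subst (λ x → Reaches G t₂ x v) (sym enumᵥ≡w) wv) (≤-trans t₂≤d d≤r)
        named = trans (proj₁ (slotOf-sound slot≡)) enumᵥ≡w
    in  j , i′ , j′ , d₂ , slot≡ , ≤-trans d₂≤t₂ t₂≤d
      , reach-mono G (m+n≤o⇒m≤o∸n t₁ (≤-trans (+-monoʳ-≤ t₁ d₂≤t₂) t₁+t₂≤d))
                     (subst (Reaches G t₁ (lookup X i)) (sym named) aw)

  slots-determine-reach : ∀ {v v′ i d} → (∀ j → slot v j ≡ slot v′ j) → d ≤ r →
                          reach G d (lookup X i) v ≡ reach G d (lookup X i) v′
  slots-determine-reach {i = i} {d} same d≤r = T-extensional (transfer same) (transfer (sym ∘ same))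
    where
    transfer : ∀ {v v′} → (∀ j → slot v j ≡ slot v′ j) → T (reach G d (lookup X i) v) → T (reach G d (lookup X i) v′)
    transfer {v} same av =
      let j , i′ , j′ , d₂ , slot≡ , d₂≤d , aw = slot-via-reach {i} {v} {d} ⟨ av ⟩ d≤r
      in  Reaches.holds (reach-via-slot (trans (sym (same j)) slot≡) d₂≤d aw)

  Dvec-determined : ∀ {v v′} → (∀ j → slot v j ≡ slot v′ j) → Dvec G r X v ≡ Dvec G r X v′
  Dvec-determined same = tabulate-cong λ i → dist-cong G r λ d d≤r → slots-determine-reach {i = i} {d} same d≤r

  NminusX-determined : ∀ {v v′} → (∀ j → slot v j ≡ slot v′ j) → NminusX G r X v ≡ NminusX G r X v′
  NminusX-determined {v} {v′} same = tabulate-cong inX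
    where
    inX : ∀ u → reach G r u v ∧ lookup (toSubset X) u ≡ reach G r u v′ ∧ lookup (toSubset X) u
    inX u with lookup (toSubset X) u in u∈X
    ... | false = trans (∧-zeroʳ _) (sym (∧-zeroʳ _))
    ... | true with anyFin-elim (λ i → does (lookup X i ≟ u)) (from T-≡ (trans (sym (lookup∘tabulate _ u)) u∈X))
    ...   | i , isU with lookup X i ≟ u | isU
    ...     | yes refl | _ = cong (_∧ true) (slots-determine-reach {i = i} same ≤-refl)

  code : Fin n → Fin (suc (k * (c * suc r)) ^ c)
  code v = funToFin (encodeTriple ∘ slot v)

  code-determines-slots : ∀ {v v′} → code v ≡ code v′ → ∀ j → slot v j ≡ slot v′ j
  code-determines-slots same j = encodeTriple-injective (funToFin-injective same j)

-- The number of codes is at most the bound of the theorem (1 ≤ k makes c·k ≥ 1 when c ≥ 1).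
slotCodes≤ : ∀ r c k → 1 ≤ k → suc (k * (c * suc r)) ^ c ≤ ((r + 2) * c * k) ^ c
slotCodes≤ r zero    k _   = ≤-refl
slotCodes≤ r (suc c) k k≥1 = ^-monoˡ-≤ (suc c) (begin
  suc (k * (suc c * suc r))         ≡⟨ +-comm 1 _ ⟩
  k * (suc c * suc r) + 1           ≤⟨ +-monoʳ-≤ (k * (suc c * suc r)) (*-mono-≤ (s≤s (z≤n {c})) k≥1) ⟩
  k * (suc c * suc r) + suc c * k   ≡⟨ regroup r (suc c) k ⟩
  (r + 2) * suc c * k               ∎)
  where
  open ≤-Reasoning
  regroup : ∀ r c k → k * (c * suc r) + c * k ≡ (r + 2) * c * k
  regroup = solve 3 (λ r c k → k :* (c :* (con 1 :+ r)) :+ c :* k := (r :+ con 2) :* c :* k) refl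

mainTheorem4 : ∀ {n k} (G : Digraph n) (X : Vec (Fin n) k) (r c : ℕ) →
    Injective _≡_ _≡_ (lookup X) → 1 ≤ k → 1 ≤ r → IsWcol G r c →
    (numDvec G r X ≤ ((r + 2) * c * k) ^ c) × (nu G r X ≤ ((r + 2) * c * k) ^ c)
mainTheorem4 G X r c _ k≥1 _ ((L , maxWReach) , _) =
    ≤-trans (countDistinct-≤ _ (Dvec G r X) code (Dvec-determined ∘ code-determines-slots)) (slotCodes≤ r c _ k≥1)
  , ≤-trans (countDistinct-≤ _ (NminusX G r X) code (NminusX-determined ∘ code-determines-slots)) (slotCodes≤ r c _ k≥1)
  where open Slots G X r c L maxWReach
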